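{- Let $n\ge 1$ and let $T$ be a semistandard skew tableau of shape $\lambda/\mu$ with $\ell(\lambda)=n$ and $n-1\le \ell(\mu)\le n$. Then, whenever the compositions involved are defined, $$\phi_i\phi_n\phi_k T=\phi_n\phi_i\phi_k T\quad\text{for } 1\le i\le k<n,$$ and $$\phi_k\phi_i\phi_n T=\phi_k\phi_n\phi_i T\quad\text{for } 1\le i<k\le n.$$ In addition, if $\ell(\mu)=n$, then $$\phi_i\phi_{n+1}\phi_k T=\phi_{n+1}\phi_i\phi_k T\quad\text{for } 1\le i\le k<n+1,$$ and $$\phi_k\phi_i\phi_{n+1} T=\phi_k\phi_{n+1}\phi_i T\quad\text{for } 1\le i<k\le n+1.$$
   Context: Partitions are identified with Young diagrams in English convention; cell $(i,j)$ is in row $i$, column $j$. For partitions $\mu\subseteq\lambda$, a semistandard skew tableau of shape $\lambda/\mu$ is a filling of the cells of $\lambda\setminus\mu$ with positive integers, weakly increasing along rows and strictly increasing down columns; $\mu$ is its inner shape and $\lambda$ its outer shape. An inner corner of a tableau $T$ of shape $\lambda/\mu$ is a cell $(i,j)\in\lambda/\mu$ with $(i-1,j),(i,j-1)\notin\lambda/\mu$; in addition, an empty cell $(i,\mu_i+1)$ is also allowed as an inner corner provided $(i-1,\mu_i+1),(i,\mu_i)\notin\lambda/\mu$. The internal row insertion operator $\phi_i$ (Sagan–Stanley) is defined on $T$ whenever $(i,\mu_i+1)$ is an inner corner of $T$. If that cell is filled, $\phi_i$ removes its entry (the cell becomes a blank cell added to the inner shape, i.e. $\mu_i$ increases by one)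 and inserts the removed entry, by ordinary Schensted row insertion, into row $i+1$: it bumps the leftmost entry of row $i+1$ strictly greater than it (or settles at the end of row $i+1$ if there is none), the bumped entry is inserted into row $i+2$ in the same way, and so on, until some entry settles at the end of a row; this adds one box to the outer shape. If the cell $(i,\mu_i+1)$ is empty, $\phi_i$ simply adjoins this blank cell to the inner shape. Compositions are written right-to-left: $\phi_a\phi_b T=\phi_a(\phi_b(T))$. -}

module Defs where

open import Data.Nat using (ℕ; zero; suc; _+_; _∸_; _≤_; _<_; _<ᵇ_; _≤ᵇ_)
open import Data.Bool using (Bool; true; false; _∧_; not; if_then_else_)
open import Data.List using (List; []; _∷_; _++_; [_]; length)
open import Data.List.Relation.Unary.All using (All)
open import Data.List.Relation.Unary.Linked using (Linked)
open import Data.Maybe using (Maybe; just; nothing; _>>=_)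
open import Data.Product using (_×_; _,_; proj₁; proj₂)
open import Relation.Binary.PropositionalEquality using (_≡_)

-- A row is a pair (μᵢ , entries): μᵢ blank cells (the inner shape part)
-- followed by the filled cells of row i, read left to right.  A tableau is the list of its rows,
-- row 1 first.  Rows not present in the list have μᵢ = λᵢ = 0.

Row : Set
Row = ℕ × List ℕ

Tableau : Set
Tableau = List Row

mu : Row → ℕ
mu = proj₁

lam : Row → ℕ
lam r = proj₁ r + length (proj₂ r)

emptyRow : Row
emptyRow = (0 , [])

-- entry in column c (1-indexed) of a row, if that cell is a filled cell
lookupℕ : List ℕ → ℕ → Maybe ℕ
lookupℕ []       _       = nothing
lookupℕ (x ∷ xs) zero    = just x
lookupℕ (x ∷ xs) (suc k) = lookupℕ xs k

entryAt : Row → ℕ → Maybe ℕ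
entryAt (m , es) c = if m <ᵇ c then lookupℕ es (c ∸ suc m) else nothing

-- Semistandard skew tableau of shape λ/μ (λ, μ partitions, μ ⊆ λ),
-- with no zero rows listed (so the list length is ℓ(λ)).

record AdjOK (r₁ r₂ : Row) : Set where
  field
    mu-decr  : mu r₂ ≤ mu r₁
    lam-decr : lam r₂ ≤ lam r₁
    col-strict : ∀ c x y → entryAt r₁ c ≡ just x → entryAt r₂ c ≡ just y → x < y

record RowOK (r : Row) : Set where
  field
    nonzero  : 0 < lam r
    weakly   : Linked _≤_ (proj₂ r)
    positive : All (1 ≤_) (proj₂ r)

IsSSYT : Tableau → Set
IsSSYT T = Linked AdjOK T × All RowOK T

ℓμ : Tableau → ℕ
ℓμ []       = 0
ℓμ (r ∷ rs) with mu r
... | zero  = ℓμ rs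
... | suc _ = suc (ℓμ rs)

ℓλ : Tableau → ℕ
ℓλ []       = 0
ℓλ (r ∷ rs) with lam r
... | zero  = ℓλ rs
... | suc _ = suc (ℓλ rs)

bump : ℕ → List ℕ → Maybe (List ℕ × ℕ)
bump x []       = nothing
bump x (y ∷ ys) with x <ᵇ y
... | true  = just (x ∷ ys , y)
... | false with bump x ys
...   | nothing        = nothing
...   | just (ys' , z) = just (y ∷ ys' , z)

insertRows : ℕ → Tableau → Tableau
insertRows x []              = (0 , [ x ]) ∷ []
insertRows x ((m , es) ∷ rs) with bump x es
... | nothing        = (m , es ++ [ x ]) ∷ rs
... | just (es' , y) = (m , es') ∷ insertRows y rs

-- (i, μᵢ+1) is an inner corner: (i-1, μᵢ+1) ∉ λ/μ (prev = row i-1, if i > 1);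
-- (i, μᵢ) ∉ λ/μ holds automatically.
cornerOK : Maybe Row → Row → Bool
cornerOK nothing  r = true
cornerOK (just p) r = not ((mu p <ᵇ suc (mu r)) ∧ (suc (mu r) ≤ᵇ lam p))

actRow : Row → Tableau → Tableau
actRow (m , [])     rs = (suc m , []) ∷ rs
actRow (m , x ∷ es) rs = (suc m , es) ∷ insertRows x rs

-- j is the 0-indexed row; prev the row above (nothing for the first row)
phiAux : ℕ → Maybe Row → Tableau → Maybe Tableau
phiAux zero    prev []       =
  if cornerOK prev emptyRow then just (actRow emptyRow []) else nothing
phiAux zero    prev (r ∷ rs) =
  if cornerOK prev r then just (actRow r rs) else nothing
phiAux (suc j) prev []       = Data.Maybe.map (emptyRow ∷_) (phiAux j (just emptyRow) [])
phiAux (suc j) prev (r ∷ rs) = Data.Maybe.map (r ∷_) (phiAux j (just r) rs)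

-- φ i T, rows indexed from 1; undefined (nothing) when (i, μᵢ+1) is not an inner corner
φ : ℕ → Tableau → Maybe Tableau
φ zero    T = nothing
φ (suc j) T = phiAux j nothing T

φ³ : ℕ → ℕ → ℕ → Tableau → Maybe Tableau
φ³ a b c T = φ c T >>= φ b >>= φ a

_≐_ : Maybe Tableau → Maybe Tableau → Set
X ≐ Y = ∀ A B → X ≡ just A → Y ≡ just B → A ≡ B

-- ψ j below is φ_{j+1} without its inner-corner test.  Whenever a composite
-- φ³ is defined it equals the corresponding composite of ψ's (φ³-ψ), so it is
-- enough to prove the identities for ψ, where they hold for every tableau
-- with weakly increasing rows; column strictness and the bounds on ℓ(μ) only
-- serve to make the φ's defined.  Writing d for the index of the last row
-- (φₙ) or of the first row below the tableau (φₙ₊₁), the identities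
--   ψ a ψ d ψ b = ψ d ψ a ψ b  (a ≤ b < d),   ψ b ψ a ψ d = ψ b ψ d ψ a  (a < b ≤ d)
-- are proved by descending through the rows on which the operators agree.
-- At the first row where they differ everything reduces to four facts about
-- inserting an entry x from the top versus applying ψ d: these commute after
-- an insertion of y ≤ x, after ψ c with c < d, before an insertion of a
-- smaller entry, and before a further ψ b with b ≤ d.  Each is proved by
-- induction down to the bottom row, where one- and two-row Schensted
-- computations remain; those rest on two facts about bumping in a single
-- sorted row, bump-monotone and bump-smaller.

module Submission where

open import Defs
open import Data.Nat using (ℕ; zero; suc; _≤_; _<_; _∸_; _<ᵇ_; _<?_; z≤n; s≤s; pred)
open import Data.Nat.Properties
  using ( ≤-refl; ≤-trans; <-trans; <⇒≤; ≤-<-trans; <-≤-trans; <ᵇ-reflects-<; <⇒≱; ≮⇒≥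
        ; ≤-pred; suc-injective)
open import Data.Bool using (true; false)
open import Data.List using (List; []; _∷_; _++_; [_]; length)
open import Data.List.Relation.Unary.All as All using (All; []; _∷_)
open import Data.List.Relation.Unary.All.Properties using (++⁺)
open import Data.List.Relation.Unary.AllPairs using (AllPairs; []; _∷_)
open import Data.List.Relation.Unary.Linked.Properties using (Linked⇒AllPairs)
open import Data.Maybe using (Maybe; just; nothing)
open import Data.Product using (_×_; _,_; proj₂; Σ-syntax)
open import Data.Empty using (⊥; ⊥-elim)
open import Relation.Nullary using (yes; no)
open import Relation.Nullary.Reflects using (ofʸ; ofⁿ)
open import Relation.Binary.PropositionalEquality
  using (_≡_; refl; sym; trans; cong; subst; module ≡-Reasoning)

ins : ℕ → Tableau → Tableau
ins = insertRows

<ᵇ-true : ∀ {x y} → x < y → (x <ᵇ y) ≡ true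
<ᵇ-true {x} {y} x<y with x <ᵇ y | <ᵇ-reflects-< x y
... | true  | _       = refl
... | false | ofⁿ x≮y = ⊥-elim (x≮y x<y)

<ᵇ-false : ∀ {x y} → y ≤ x → (x <ᵇ y) ≡ false
<ᵇ-false {x} {y} y≤x with x <ᵇ y | <ᵇ-reflects-< x y
... | false | _       = refl
... | true  | ofʸ x<y = ⊥-elim (<⇒≱ x<y y≤x)

Sorted : List ℕ → Set
Sorted = AllPairs _≤_

bump-below : ∀ {x y ys} → x < y → bump x (y ∷ ys) ≡ just (x ∷ ys , y)
bump-below x<y rewrite <ᵇ-true x<y = refl

bump-skip-nothing : ∀ {x y ys} → y ≤ x → bump x ys ≡ nothing → bump x (y ∷ ys) ≡ nothing
bump-skip-nothing y≤x e rewrite <ᵇ-false y≤x | e = refl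

bump-skip-just : ∀ {x y ys ys' z} → y ≤ x → bump x ys ≡ just (ys' , z) →
  bump x (y ∷ ys) ≡ just (y ∷ ys' , z)
bump-skip-just y≤x e rewrite <ᵇ-false y≤x | e = refl

data BumpView (x y : ℕ) (ys : List ℕ) : Maybe (List ℕ × ℕ) → Set where
  bumps-head : x < y → BumpView x y ys (just (x ∷ ys , y))
  no-bump    : y ≤ x → bump x ys ≡ nothing → BumpView x y ys nothing
  bumps-tail : ∀ ys' z → y ≤ x → bump x ys ≡ just (ys' , z) → BumpView x y ys (just (y ∷ ys' , z))

bumpView : ∀ x y ys → BumpView x y ys (bump x (y ∷ ys))
bumpView x y ys with x <ᵇ y | <ᵇ-reflects-< x y
... | true  | ofʸ x<y = bumps-head x<y
... | false | ofⁿ x≮y with bump x ys in e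
...   | nothing        = no-bump (≮⇒≥ x≮y) e
...   | just (ys' , z) = bumps-tail ys' z (≮⇒≥ x≮y) e

bounded⇒unbumped : ∀ {x es} → All (_≤ x) es → bump x es ≡ nothing
bounded⇒unbumped []         = refl
bounded⇒unbumped (p ∷ ps) = bump-skip-nothing p (bounded⇒unbumped ps)

unbumped⇒bounded : ∀ {x es} → bump x es ≡ nothing → All (_≤ x) es
unbumped⇒bounded {x} {[]}     _ = []
unbumped⇒bounded {x} {y ∷ ys} e with bump x (y ∷ ys) | bumpView x y ys
unbumped⇒bounded ()  | _ | bumps-head _
unbumped⇒bounded {x} {y ∷ ys} refl | _ | no-bump y≤x e′ = y≤x ∷ unbumped⇒bounded {es = ys} e′
unbumped⇒bounded ()  | _ | bumps-tail _ _ _ _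

appended-bounded : ∀ {x y} es → y ≤ x → All (_≤ y) es → All (_≤ x) (es ++ [ y ])
appended-bounded es y≤x es≤y = ++⁺ (All.map (λ p → ≤-trans p y≤x) es≤y) (y≤x ∷ [])

bumped-satisfies : ∀ {P : ℕ → Set} {x es es' z} → All P es → bump x es ≡ just (es' , z) → P z
bumped-satisfies {x = x} {es = y ∷ ys} (p ∷ ps) e with bump x (y ∷ ys) | bumpView x y ys
bumped-satisfies (p ∷ ps) refl | _ | bumps-head _          = p
bumped-satisfies (p ∷ ps) ()   | _ | no-bump _ _
bumped-satisfies (p ∷ ps) refl | _ | bumps-tail _ _ _ e′ = bumped-satisfies ps e′

bump-preserves : ∀ {P : ℕ → Set} {x es es' z} → All P es → P x → bump x es ≡ just (es' , z) → All P es'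
bump-preserves {x = x} {es = y ∷ ys} (p ∷ ps) px e with bump x (y ∷ ys) | bumpView x y ys
bump-preserves (p ∷ ps) px refl | _ | bumps-head _          = px ∷ ps
bump-preserves (p ∷ ps) px ()   | _ | no-bump _ _
bump-preserves (p ∷ ps) px refl | _ | bumps-tail _ _ _ e′ = p ∷ bump-preserves ps px e′

bumped-larger : ∀ {x es es' z} → bump x es ≡ just (es' , z) → x < z
bumped-larger {x} {y ∷ ys} e with bump x (y ∷ ys) | bumpView x y ys
bumped-larger refl | _ | bumps-head x<y = x<y
bumped-larger ()   | _ | no-bump _ _
bumped-larger {x} {y ∷ ys} refl | _ | bumps-tail _ _ _ e′ = bumped-larger {es = ys} e′

bumped-head-≤ : ∀ {x es h t z} → bump x es ≡ just (h ∷ t , z) → h ≤ x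
bumped-head-≤ {x} {y ∷ ys} e with bump x (y ∷ ys) | bumpView x y ys
bumped-head-≤ refl | _ | bumps-head _         = ≤-refl
bumped-head-≤ ()   | _ | no-bump _ _
bumped-head-≤ refl | _ | bumps-tail _ _ y≤x _ = y≤x

bumped-nonempty : ∀ {x es z} → bump x es ≡ just ([] , z) → ⊥
bumped-nonempty {x} {y ∷ ys} e with bump x (y ∷ ys) | bumpView x y ys
bumped-nonempty () | _ | bumps-head _
bumped-nonempty () | _ | no-bump _ _
bumped-nonempty () | _ | bumps-tail _ _ _ _

unbumped-never-bumps : ∀ {x es es' z} → bump x es ≡ nothing → bump x es ≡ just (es' , z) → ⊥
unbumped-never-bumps e e′ with trans (sym e) e′
... | ()

bump-monotone : ∀ {y x es es₁ z es₂ z'} → Sorted es → y ≤ x →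
  bump y es ≡ just (es₁ , z) → bump x es₁ ≡ just (es₂ , z') → z ≤ z'
bump-monotone {y} {x} {e ∷ es} (e≤es ∷ sorted) y≤x e₁ e₂ with bump y (e ∷ es) | bumpView y e es
bump-monotone {y} {x} {e ∷ es} (e≤es ∷ sorted) y≤x refl e₂ | _ | bumps-head _
  with bump x (y ∷ es) | bumpView x y es
... | _ | bumps-head x<y = ⊥-elim (<⇒≱ x<y y≤x)
bump-monotone (e≤es ∷ sorted) y≤x refl () | _ | bumps-head _ | _ | no-bump _ _
bump-monotone (e≤es ∷ sorted) y≤x refl refl | _ | bumps-head _ | _ | bumps-tail _ _ _ e₃ =
  bumped-satisfies e≤es e₃
bump-monotone (e≤es ∷ sorted) y≤x () e₂ | _ | no-bump _ _
bump-monotone {y} {x} {e ∷ es} (e≤es ∷ sorted) y≤x refl e₂ | _ | bumps-tail es₁ _ e≤y e₁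
  with bump x (e ∷ es₁) | bumpView x e es₁
... | _ | bumps-head x<e = ⊥-elim (<⇒≱ x<e (≤-trans e≤y y≤x))
bump-monotone (e≤es ∷ sorted) y≤x refl () | _ | bumps-tail _ _ _ _ | _ | no-bump _ _
bump-monotone (e≤es ∷ sorted) y≤x refl refl | _ | bumps-tail _ _ _ e₁ | _ | bumps-tail _ _ _ e₃ =
  bump-monotone sorted y≤x e₁ e₃

bump-smaller : ∀ {z h es es' z'} → bump z es ≡ just (es' , z') → h < z →
  Σ[ es'' ∈ List ℕ ] Σ[ z'' ∈ ℕ ] bump h es' ≡ just (es'' , z'') × z'' ≤ z
bump-smaller {z} {h} {e ∷ es} e₁ h<z with bump z (e ∷ es) | bumpView z e es
bump-smaller {z} {h} {e ∷ es} refl h<z | _ | bumps-head _ = h ∷ es , z , bump-below h<z , ≤-refl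
bump-smaller () h<z | _ | no-bump _ _
bump-smaller {z} {h} {e ∷ es} refl h<z | _ | bumps-tail es' _ e≤z e₁ with h <? e
... | yes h<e = h ∷ es' , e , bump-below h<e , e≤z
... | no h≮e with bump-smaller {es = es} e₁ h<z
...   | es'' , z'' , e₂ , z''≤z = e ∷ es'' , z'' , bump-skip-just (≮⇒≥ h≮e) e₂ , z''≤z

data BumpCase (x : ℕ) (es : List ℕ) : Set where
  unbumped : bump x es ≡ nothing → BumpCase x es
  bumped   : ∀ es' z → bump x es ≡ just (es' , z) → BumpCase x es

bumpCase : ∀ x es → BumpCase x es
bumpCase x es with bump x es in e
... | nothing        = unbumped e
... | just (es' , z) = bumped es' z e

ins-appends : ∀ {x m es rs} → bump x es ≡ nothing → ins x ((m , es) ∷ rs) ≡ (m , es ++ [ x ]) ∷ rs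
ins-appends e rewrite e = refl

ins-bumps : ∀ {x m es rs es' y} → bump x es ≡ just (es' , y) → ins x ((m , es) ∷ rs) ≡ (m , es') ∷ ins y rs
ins-bumps e rewrite e = refl

-- ψ j T: the internal insertion φ_{j+1} without the inner-corner test, with
-- rows counted from 0: row j loses its first cell to the inner shape and its
-- entry, if any, is inserted into the rows below.
ψ : ℕ → Tableau → Tableau
ψ zero    []       = actRow emptyRow []
ψ zero    (r ∷ rs) = actRow r rs
ψ (suc j) []       = emptyRow ∷ ψ j []
ψ (suc j) (r ∷ rs) = r ∷ ψ j rs

SortedRows : Tableau → Set
SortedRows = All (λ r → Sorted (proj₂ r))

-- BottomRow d R: row d is the last row of R or the first empty row below it,
-- i.e. the row on which φₙ resp. φₙ₊₁ acts.
data BottomRow : ℕ → Tableau → Set where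
  past-end : BottomRow 0 []
  last-row : ∀ {r} → BottomRow 0 (r ∷ [])
  row-above : ∀ {d r R} → BottomRow d R → BottomRow (suc d) (r ∷ R)

InsCommutes : ℕ → ℕ → Tableau → Set
InsCommutes x d V = ins x (ψ d V) ≡ ψ d (ins x V)

swap-pair : ∀ {a b c k} → a < b → b ≤ c →
  ins c (ins a ((k , b ∷ []) ∷ [])) ≡ ins a (ins c ((k , b ∷ []) ∷ []))
swap-pair a<b b≤c rewrite <ᵇ-false b≤c | <ᵇ-true a<b | <ᵇ-false (≤-trans (<⇒≤ a<b) b≤c) = refl

merge-pair : ∀ {e g z k} → e ≤ g → g < z →
  ins g (ins z ((k , e ∷ []) ∷ [])) ≡ ins g (ins e ((k , z ∷ []) ∷ []))
merge-pair e≤g g<z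
  rewrite <ᵇ-false (<⇒≤ (≤-<-trans e≤g g<z)) | <ᵇ-true (≤-<-trans e≤g g<z)
        | <ᵇ-false e≤g | <ᵇ-true g<z = refl

ins-commutes-top : ∀ {x h t m W} → h ≤ x →
  (∀ {t' v} → bump x t ≡ just (t' , v) → ins v (ins h W) ≡ ins h (ins v W)) →
  InsCommutes x 0 ((m , h ∷ t) ∷ W)
ins-commutes-top {x} {h} {t} {m} {W} h≤x swap with bumpCase x t
... | unbumped e =
  trans (ins-appends {rs = ins h W} e)
    (sym (cong (ψ 0) (ins-appends {m = m} {rs = W} (bump-skip-nothing {ys = t} h≤x e))))
... | bumped t' v e =
  trans (ins-bumps {rs = ins h W} e) (trans (cong ((suc m , t') ∷_) (swap e))
    (sym (cong (ψ 0) (ins-bumps {m = m} {es = h ∷ t} {rs = W} (bump-skip-just {ys = t} h≤x e)))))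

ins-commutes-top-unbumped : ∀ {x h t m W} → h ≤ x → bump x t ≡ nothing →
  InsCommutes x 0 ((m , h ∷ t) ∷ W)
ins-commutes-top-unbumped {t = t} h≤x e =
  ins-commutes-top h≤x (λ e′ → ⊥-elim (unbumped-never-bumps {es = t} e e′))

ins-commutes-top-bounded : ∀ {x h t m W} → All (_≤ x) (h ∷ t) → InsCommutes x 0 ((m , h ∷ t) ∷ W)
ins-commutes-top-bounded (h≤x ∷ t≤x) = ins-commutes-top-unbumped h≤x (bounded⇒unbumped t≤x)

ins-commutes-top-appended : ∀ {x y m W} es → y ≤ x → All (_≤ y) es →
  InsCommutes x 0 ((m , es ++ [ y ]) ∷ W)
ins-commutes-top-appended []       y≤x _    = ins-commutes-top-bounded (y≤x ∷ [])
ins-commutes-top-appended (e ∷ es) y≤x es≤y = ins-commutes-top-bounded (appended-bounded (e ∷ es) y≤x es≤y)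

-- Above row d the insertion passes ψ d unchanged; it remains to commute the
-- bumped entry with ψ d on the rows below.
ins-commutes-through-row : ∀ {x m es V d} →
  (∀ {es' z} → bump x es ≡ just (es' , z) → InsCommutes z d V) →
  InsCommutes x (suc d) ((m , es) ∷ V)
ins-commutes-through-row {x} {m} {es} h with bump x es in e
... | nothing        = refl
... | just (es' , z) = cong ((m , es') ∷_) (h refl)

ins-commutes-after-smaller-single : ∀ {x y m es} → y ≤ x → Sorted es →
  InsCommutes x 0 (ins y ((m , es) ∷ []))
ins-commutes-after-smaller-single {x} {y} {m} {es} y≤x sorted with bump y es in e₁
... | nothing          = ins-commutes-top-appended es y≤x (unbumped⇒bounded {es = es} e₁)
... | just ([] , z)    = ⊥-elim (bumped-nonempty {es = es} e₁)
... | just (h ∷ t , z) = ins-commutes-top h≤x (λ e₂ →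
      swap-pair (≤-<-trans h≤y (bumped-larger {es = es} e₁))
                (bump-monotone sorted y≤x e₁ (bump-skip-just {ys = t} h≤x e₂)))
  where
  h≤y : h ≤ y
  h≤y = bumped-head-≤ {es = es} e₁
  h≤x : h ≤ x
  h≤x = ≤-trans h≤y y≤x

ins-commutes-after-smaller : ∀ {x y d R} → y ≤ x → BottomRow d R → SortedRows R →
  InsCommutes x d (ins y R)
ins-commutes-after-smaller y≤x past-end _              = ins-commutes-after-smaller-single {m = 0} {es = []} y≤x []
ins-commutes-after-smaller y≤x last-row (sorted ∷ _) = ins-commutes-after-smaller-single y≤x sorted
ins-commutes-after-smaller {x} {y} {R = (m , es) ∷ R} y≤x (row-above bot) (sorted ∷ rows) with bump y es in e₁
... | nothing = ins-commutes-through-row {es = es ++ [ y ]} {V = R} λ e₂ →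
      ⊥-elim (unbumped-never-bumps {es = es ++ [ y ]} appended-unbumped e₂)
  where
  appended-unbumped : bump x (es ++ [ y ]) ≡ nothing
  appended-unbumped = bounded⇒unbumped (appended-bounded es y≤x (unbumped⇒bounded {es = es} e₁))
... | just (es₁ , z) = ins-commutes-through-row {es = es₁} {V = ins z R} λ e₂ →
      ins-commutes-after-smaller (bump-monotone sorted y≤x e₁ e₂) bot rows

ins-commutes-after-ψ-above : ∀ {x c d R} → c < d → BottomRow d R → SortedRows R →
  InsCommutes x d (ψ c R)
ins-commutes-after-ψ-above {c = zero} {R = (m , []) ∷ R} _ (row-above {d} _) _ =
  ins-commutes-through-row {es = []} {V = R} {d = d} λ ()
ins-commutes-after-ψ-above {c = zero} {R = (m , y ∷ es) ∷ R} _ (row-above bot) ((y≤es ∷ _) ∷ rows) =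
  ins-commutes-through-row {es = es} {V = ins y R} λ e →
    ins-commutes-after-smaller (bumped-satisfies {es = es} y≤es e) bot rows
ins-commutes-after-ψ-above {c = suc c} {R = (m , es) ∷ R} (s≤s c<d) (row-above bot) (_ ∷ rows) =
  ins-commutes-through-row {es = es} {V = ψ c R} λ _ → ins-commutes-after-ψ-above c<d bot rows

-- Inserting z commutes with the bottom ψ d once an entry h < z is inserted
-- afterwards (without it, it fails already for one empty row).
before-smaller-bumps-head : ∀ {h z m e es} → h < z → z < e → Sorted (e ∷ es) →
  ins h (ins z (ψ 0 ((m , e ∷ es) ∷ []))) ≡ ins h (ψ 0 (ins z ((m , e ∷ es) ∷ [])))
before-smaller-bumps-head {h} {z} {m} {e} {[]} h<z z<e _ =
  trans (ins-bumps {m = suc m} {es = z ∷ []} {rs = (0 , e ∷ []) ∷ []} (bump-below h<z))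
    (cong (λ V → ins h (ψ 0 V)) (sym (ins-bumps {m = m} {es = e ∷ []} {rs = []} (bump-below z<e))))
before-smaller-bumps-head {h} {z} {m} {e} {f ∷ es} h<z z<e ((e≤f ∷ _) ∷ _) = begin
  ins h (ins z ((suc m , f ∷ es) ∷ (0 , e ∷ []) ∷ []))
    ≡⟨ cong (ins h) (ins-bumps {m = suc m} {es = f ∷ es} {rs = (0 , e ∷ []) ∷ []} (bump-below z<f)) ⟩
  ins h ((suc m , z ∷ es) ∷ ins f ((0 , e ∷ []) ∷ []))
    ≡⟨ ins-bumps {es = z ∷ es} (bump-below h<z) ⟩
  (suc m , h ∷ es) ∷ ins z (ins f ((0 , e ∷ []) ∷ []))
    ≡⟨ cong ((suc m , h ∷ es) ∷_) (sym (swap-pair z<e e≤f)) ⟩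
  (suc m , h ∷ es) ∷ ins f (ins z ((0 , e ∷ []) ∷ []))
    ≡⟨ sym (ins-bumps {es = f ∷ es} (bump-below (<-trans h<z z<f))) ⟩
  ins h ((suc m , f ∷ es) ∷ ins z ((0 , e ∷ []) ∷ []))
    ≡⟨ cong (λ V → ins h (ψ 0 V)) (sym (ins-bumps {m = m} {es = e ∷ f ∷ es} {rs = []} (bump-below z<e))) ⟩
  ins h (ψ 0 (ins z ((m , e ∷ f ∷ es) ∷ []))) ∎
  where
  open ≡-Reasoning
  z<f : z < f
  z<f = <-≤-trans z<e e≤f

before-smaller-passes-head : ∀ {h z m e es} → h < z → e ≤ z → Sorted (e ∷ es) →
  ins h (ins z (ψ 0 ((m , e ∷ es) ∷ []))) ≡ ins h (ψ 0 (ins z ((m , e ∷ es) ∷ [])))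
before-smaller-passes-head {h} {z} {m} {e} {es} h<z e≤z (e≤es ∷ _) with bumpCase z es
... | unbumped e₁ = cong (ins h) (ins-commutes-top-unbumped {t = es} e≤z e₁)
... | bumped es' z' e₁ with bump-smaller {es = es} e₁ h<z
...   | es'' , z'' , e₂ , z''≤z = begin
  ins h (ins z ((suc m , es) ∷ (0 , e ∷ []) ∷ []))
    ≡⟨ cong (ins h) (ins-bumps {m = suc m} {es = es} {rs = (0 , e ∷ []) ∷ []} e₁) ⟩
  ins h ((suc m , es') ∷ ins z' ((0 , e ∷ []) ∷ []))
    ≡⟨ ins-bumps {es = es'} e₂ ⟩
  (suc m , es'') ∷ ins z'' (ins z' ((0 , e ∷ []) ∷ []))
    ≡⟨ cong ((suc m , es'') ∷_) (merge-pair e≤z'' (≤-<-trans z''≤z (bumped-larger {es = es} e₁))) ⟩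
  (suc m , es'') ∷ ins z'' (ins e ((0 , z' ∷ []) ∷ []))
    ≡⟨ sym (ins-bumps {es = es'} e₂) ⟩
  ins h ((suc m , es') ∷ ins e ((0 , z' ∷ []) ∷ []))
    ≡⟨ cong (λ V → ins h (ψ 0 V)) (sym (ins-bumps {m = m} {es = e ∷ es} {rs = []} (bump-skip-just {ys = es} e≤z e₁))) ⟩
  ins h (ψ 0 (ins z ((m , e ∷ es) ∷ []))) ∎
  where
  open ≡-Reasoning
  e≤z'' : e ≤ z''
  e≤z'' = bumped-satisfies {es = es'} (bump-preserves {es = es} e≤es e≤z e₁) e₂

ins-commutes-before-smaller-single : ∀ {h z m es} → h < z → Sorted es →
  ins h (ins z (ψ 0 ((m , es) ∷ []))) ≡ ins h (ψ 0 (ins z ((m , es) ∷ [])))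
ins-commutes-before-smaller-single {es = []} h<z _ = ins-bumps (bump-below h<z)
ins-commutes-before-smaller-single {z = z} {es = e ∷ _} h<z sorted with z <? e
... | yes z<e = before-smaller-bumps-head h<z z<e sorted
... | no z≮e  = before-smaller-passes-head h<z (≮⇒≥ z≮e) sorted

ins-commutes-before-smaller : ∀ {h z d R} → h < z → BottomRow d R → SortedRows R →
  ins h (ins z (ψ d R)) ≡ ins h (ψ d (ins z R))
ins-commutes-before-smaller h<z past-end _              = ins-commutes-before-smaller-single {m = 0} {es = []} h<z []
ins-commutes-before-smaller h<z last-row (sorted ∷ _) = ins-commutes-before-smaller-single h<z sorted
ins-commutes-before-smaller {h} {z} {R = (m , es) ∷ R} h<z (row-above bot) (_ ∷ rows) with bump z es in e₁
... | nothing         = refl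
... | just (es' , z') with bump-smaller {es = es} e₁ h<z
...   | es'' , z'' , e₂ , z''≤z =
  trans (ins-bumps {es = es'} e₂)
    (trans (cong ((m , es'') ∷_)
             (ins-commutes-before-smaller (≤-<-trans z''≤z (bumped-larger {es = es} e₁)) bot rows))
      (sym (ins-bumps {es = es'} e₂)))

before-ψ-bumps-head : ∀ {y m e es} → y < e → Sorted (e ∷ es) →
  ψ 0 (ins y (ψ 0 ((m , e ∷ es) ∷ []))) ≡ ψ 0 (ψ 0 (ins y ((m , e ∷ es) ∷ [])))
before-ψ-bumps-head {y} {m} {e} {[]} y<e _ =
  cong (λ V → ψ 0 (ψ 0 V)) (sym (ins-bumps {m = m} {es = e ∷ []} {rs = []} (bump-below y<e)))
before-ψ-bumps-head {y} {m} {e} {f ∷ es} y<e ((e≤f ∷ _) ∷ _) = begin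
  ψ 0 (ins y ((suc m , f ∷ es) ∷ (0 , e ∷ []) ∷ []))
    ≡⟨ cong (ψ 0) (ins-bumps {m = suc m} {es = f ∷ es} {rs = (0 , e ∷ []) ∷ []} (bump-below (<-≤-trans y<e e≤f))) ⟩
  (suc (suc m) , es) ∷ ins y (ins f ((0 , e ∷ []) ∷ []))
    ≡⟨ cong ((suc (suc m) , es) ∷_) (sym (swap-pair y<e e≤f)) ⟩
  (suc (suc m) , es) ∷ ins f (ins y ((0 , e ∷ []) ∷ []))
    ≡⟨ cong (λ V → ψ 0 (ψ 0 V)) (sym (ins-bumps {m = m} {es = e ∷ f ∷ es} {rs = []} (bump-below y<e))) ⟩
  ψ 0 (ψ 0 (ins y ((m , e ∷ f ∷ es) ∷ []))) ∎
  where open ≡-Reasoning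

before-ψ-passes-head : ∀ {y m e es} → e ≤ y → Sorted (e ∷ es) →
  ψ 0 (ins y (ψ 0 ((m , e ∷ es) ∷ []))) ≡ ψ 0 (ψ 0 (ins y ((m , e ∷ es) ∷ [])))
before-ψ-passes-head {y} {m} {e} {es} e≤y (e≤es ∷ _) with bumpCase y es
... | unbumped e₁ = cong (ψ 0) (ins-commutes-top-unbumped {t = es} e≤y e₁)
... | bumped [] z e₁ = ⊥-elim (bumped-nonempty {es = es} e₁)
... | bumped (g ∷ es') z e₁ = begin
  ψ 0 (ins y ((suc m , es) ∷ (0 , e ∷ []) ∷ []))
    ≡⟨ cong (ψ 0) (ins-bumps {m = suc m} {es = es} {rs = (0 , e ∷ []) ∷ []} e₁) ⟩
  (suc (suc m) , es') ∷ ins g (ins z ((0 , e ∷ []) ∷ []))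
    ≡⟨ cong ((suc (suc m) , es') ∷_) (merge-pair e≤g g<z) ⟩
  (suc (suc m) , es') ∷ ins g (ins e ((0 , z ∷ []) ∷ []))
    ≡⟨ cong (λ V → ψ 0 (ψ 0 V)) (sym (ins-bumps {m = m} {es = e ∷ es} {rs = []} (bump-skip-just {ys = es} e≤y e₁))) ⟩
  ψ 0 (ψ 0 (ins y ((m , e ∷ es) ∷ []))) ∎
  where
  open ≡-Reasoning
  e≤g : e ≤ g
  e≤g = All.head (bump-preserves {es = es} e≤es e≤y e₁)
  g<z : g < z
  g<z = ≤-<-trans (bumped-head-≤ {es = es} e₁) (bumped-larger {es = es} e₁)

ins-commutes-before-ψ-single : ∀ {y m es} → Sorted es →
  ψ 0 (ins y (ψ 0 ((m , es) ∷ []))) ≡ ψ 0 (ψ 0 (ins y ((m , es) ∷ [])))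
ins-commutes-before-ψ-single {es = []} _ = refl
ins-commutes-before-ψ-single {y} {es = e ∷ _} sorted with y <? e
... | yes y<e = before-ψ-bumps-head y<e sorted
... | no y≮e  = before-ψ-passes-head (≮⇒≥ y≮e) sorted

ins-commutes-before-ψ : ∀ {y b d R} → b ≤ d → BottomRow d R → SortedRows R →
  ψ b (ins y (ψ d R)) ≡ ψ b (ψ d (ins y R))
ins-commutes-before-ψ z≤n past-end _ = refl
ins-commutes-before-ψ z≤n last-row (sorted ∷ _) = ins-commutes-before-ψ-single sorted
ins-commutes-before-ψ {y} {R = (m , es) ∷ R} z≤n (row-above bot) (_ ∷ rows) with bump y es in e₁
... | nothing          = refl
... | just ([] , z)    = ⊥-elim (bumped-nonempty {es = es} e₁)
... | just (h ∷ t , z) = cong ((suc m , t) ∷_)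
      (ins-commutes-before-smaller (≤-<-trans (bumped-head-≤ {es = es} e₁) (bumped-larger {es = es} e₁)) bot rows)
ins-commutes-before-ψ {y} {R = (m , es) ∷ R} (s≤s b≤d) (row-above bot) (_ ∷ rows) with bump y es in e₁
... | nothing          = refl
... | just (es' , z)   = cong ((m , es') ∷_) (ins-commutes-before-ψ b≤d bot rows)

ψ-top-commutes : ∀ {m es d V} → (∀ {x t} → es ≡ x ∷ t → InsCommutes x d V) →
  ψ 0 (ψ (suc d) ((m , es) ∷ V)) ≡ ψ (suc d) (ψ 0 ((m , es) ∷ V))
ψ-top-commutes {es = []}    _    = refl
ψ-top-commutes {m} {x ∷ t} head = cong ((suc m , t) ∷_) (head refl)

ψ-bottom-commutes-after : ∀ {a b d T} → a ≤ b → b < d → BottomRow d T → SortedRows T →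
  ψ a (ψ d (ψ b T)) ≡ ψ d (ψ a (ψ b T))
ψ-bottom-commutes-after {zero} {zero} {T = (m , []) ∷ R} _ _ (row-above _) _ = refl
ψ-bottom-commutes-after {zero} {zero} {T = (m , y ∷ es) ∷ R} _ _ (row-above bot) ((y≤es ∷ _) ∷ rows) =
  ψ-top-commutes λ { refl → ins-commutes-after-smaller (All.head y≤es) bot rows }
ψ-bottom-commutes-after {zero} {suc c} {T = (m , es) ∷ R} _ c<d (row-above bot) (_ ∷ rows) =
  ψ-top-commutes λ _ → ins-commutes-after-ψ-above (≤-pred c<d) bot rows
ψ-bottom-commutes-after {suc a} {suc c} {T = r ∷ R} (s≤s a≤c) (s≤s c<d) (row-above bot) (_ ∷ rows) =
  cong (r ∷_) (ψ-bottom-commutes-after a≤c c<d bot rows)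

ψ-bottom-commutes-before : ∀ {a b d T} → a < b → b ≤ d → BottomRow d T → SortedRows T →
  ψ b (ψ a (ψ d T)) ≡ ψ b (ψ d (ψ a T))
ψ-bottom-commutes-before {zero} {suc b} {T = (m , []) ∷ R} _ _ (row-above _) _ = refl
ψ-bottom-commutes-before {zero} {suc b} {T = (m , y ∷ es) ∷ R} _ (s≤s b≤d) (row-above bot) (_ ∷ rows) =
  cong ((suc m , es) ∷_) (ins-commutes-before-ψ b≤d bot rows)
ψ-bottom-commutes-before {suc a} {suc b} {T = r ∷ R} (s≤s a<b) (s≤s b≤d) (row-above bot) (_ ∷ rows) =
  cong (r ∷_) (ψ-bottom-commutes-before a<b b≤d bot rows)

phiAux-ψ : ∀ j p T {X} → phiAux j p T ≡ just X → X ≡ ψ j T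
phiAux-ψ zero    p []       e with cornerOK p emptyRow
phiAux-ψ zero    p []       refl | true = refl
phiAux-ψ zero    p []       ()   | false
phiAux-ψ zero    p (r ∷ rs) e with cornerOK p r
phiAux-ψ zero    p (r ∷ rs) refl | true = refl
phiAux-ψ zero    p (r ∷ rs) ()   | false
phiAux-ψ (suc j) p []       e with phiAux j (just emptyRow) [] in e′
phiAux-ψ (suc j) p []       refl | just Y = cong (emptyRow ∷_) (phiAux-ψ j (just emptyRow) [] e′)
phiAux-ψ (suc j) p []       ()   | nothing
phiAux-ψ (suc j) p (r ∷ rs) e with phiAux j (just r) rs in e′
phiAux-ψ (suc j) p (r ∷ rs) refl | just Y = cong (r ∷_) (phiAux-ψ j (just r) rs e′)
phiAux-ψ (suc j) p (r ∷ rs) ()   | nothing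

φ-ψ : ∀ i T {X} → φ i T ≡ just X → X ≡ ψ (pred i) T
φ-ψ (suc j) T e = phiAux-ψ j nothing T e

φ³-ψ : ∀ a b c T {A} → φ³ a b c T ≡ just A → A ≡ ψ (pred a) (ψ (pred b) (ψ (pred c) T))
φ³-ψ a b c T e with φ c T in e₁
... | just X with φ b X in e₂
...   | just Y =
  trans (φ-ψ a Y e) (cong (ψ (pred a)) (trans (φ-ψ b X e₂) (cong (ψ (pred b)) (φ-ψ c T e₁))))

φ³-agree : ∀ a b c a' b' c' T →
  ψ (pred a) (ψ (pred b) (ψ (pred c) T)) ≡ ψ (pred a') (ψ (pred b') (ψ (pred c') T)) →
  φ³ a b c T ≐ φ³ a' b' c' T
φ³-agree a b c a' b' c' T same A B eA eB = trans (φ³-ψ a b c T eA) (trans same (sym (φ³-ψ a' b' c' T eB)))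

φ-bottom-commutes-after : ∀ {d T} → BottomRow d T → SortedRows T →
  ∀ i k → 1 ≤ i → i ≤ k → k < suc d → φ³ i (suc d) k T ≐ φ³ (suc d) i k T
φ-bottom-commutes-after {d} {T} bot rows (suc a) (suc b) _ (s≤s a≤b) (s≤s b<d) =
  φ³-agree (suc a) (suc d) (suc b) (suc d) (suc a) (suc b) T (ψ-bottom-commutes-after a≤b b<d bot rows)

φ-bottom-commutes-before : ∀ {d T} → BottomRow d T → SortedRows T →
  ∀ i k → 1 ≤ i → i < k → k ≤ suc d → φ³ k i (suc d) T ≐ φ³ k (suc d) i T
φ-bottom-commutes-before {d} {T} bot rows (suc a) (suc b) _ (s≤s a<b) (s≤s b≤d) =
  φ³-agree (suc b) (suc a) (suc d) (suc b) (suc d) (suc a) T (ψ-bottom-commutes-before a<b b≤d bot rows)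

ℓλ≡length : ∀ {T} → All RowOK T → ℓλ T ≡ length T
ℓλ≡length [] = refl
ℓλ≡length {r ∷ _} (ok ∷ oks) with lam r | RowOK.nonzero ok
... | suc _ | _ = cong suc (ℓλ≡length oks)

rows-sorted : ∀ {T} → All RowOK T → SortedRows T
rows-sorted = All.map (λ ok → Linked⇒AllPairs ≤-trans (RowOK.weakly ok))

bottom-of-length : ∀ {d} R → length R ≡ suc d → BottomRow d R
bottom-of-length {zero}  (r ∷ [])    refl = last-row
bottom-of-length {suc d} (r ∷ R)     len  = row-above (bottom-of-length R (suc-injective len))

below-of-length : ∀ R → BottomRow (length R) R
below-of-length []      = past-end
below-of-length (r ∷ R) = row-above (below-of-length R)

-- With n = L + 1 rows, φₙ acts at the last row L and φₙ₊₁ at the row L + 1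
-- just below the tableau; both are bottom indices, so the two identities apply.
lemma4p2 : (n : ℕ) (T : Tableau) → 1 ≤ n → IsSSYT T → ℓλ T ≡ n →
    n ∸ 1 ≤ ℓμ T → ℓμ T ≤ n →
    (∀ i k → 1 ≤ i → i ≤ k → k < n → φ³ i n k T ≐ φ³ n i k T)
    × (∀ i k → 1 ≤ i → i < k → k ≤ n → φ³ k i n T ≐ φ³ k n i T)
    × (ℓμ T ≡ n →
    (∀ i k → 1 ≤ i → i ≤ k → k < suc n → φ³ i (suc n) k T ≐ φ³ (suc n) i k T)
    × (∀ i k → 1 ≤ i → i < k → k ≤ suc n → φ³ k i (suc n) T ≐ φ³ k (suc n) i T))
lemma4p2 (suc L) T _ (_ , rowsOK) ℓλ≡n _ _ =
  φ-bottom-commutes-after last sorted , φ-bottom-commutes-before last sorted ,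
  λ _ → φ-bottom-commutes-after below sorted , φ-bottom-commutes-before below sorted
  where
  sorted : SortedRows T
  sorted = rows-sorted rowsOK
  len : length T ≡ suc L
  len = trans (sym (ℓλ≡length rowsOK)) ℓλ≡n
  last : BottomRow L T
  last = bottom-of-length T len
  below : BottomRow (suc L) T
  below = subst (λ d → BottomRow d T) len (below-of-length T)
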